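{- Let $\mathcal{C}$ be a circuit family as in the context, and let $g,h$ be functions in $\mathbb{ACDL}_{\mathcal{C}}$, $k\in\mathbb{N}$, and $\vec x=x_1,\dots,x_h$. Then for every $\triangleright\in\{<,\le,>,\ge,=\}$ and $j\in\{0,1\}$, the function $\vec x\mapsto \min_{i\le \ell(x_1)^k}\{g(i,\vec x): h(i,\vec x)\triangleright j\}$ belongs to $\mathbb{ACDL}_{\mathcal{C}}$.
   Context: $\ell(x)=\lceil\log_2(x+1)\rceil$ is the binary length of $x$; $\mathrm{sg}(x)=1$ if $x>0$, else $0$; $x\div2=\lfloor x/2\rfloor$. The length-ODE $\frac{\partial f(x,\vec y)}{\partial \ell}=E(x,\vec y)$ means $f(x+1,\vec y)=f(x,\vec y)+(\ell(x+1)-\ell(x))\cdot E(x,\vec y)$. Schema $\ell$-ODE$_2$: given $g,h,k$ with $h\in\{0,1\}$ and $k(\vec y)\ne0$ whenever $h(x,\vec y)=1$ for some $x$, $f$ solves $f(0,\vec y)=g(\vec y)$, $\frac{\partial f}{\partial\ell}=(2^{\ell(k(\vec y))}-1)f(x,\vec y)+h(x,\vec y)$. Schema $\ell$-ODE$_3$: $f(0,\vec y)=g(\vec y)$, $\frac{\partial f}{\partial\ell}=-(f(x,\vec y)-(f(x,\vec y)\div 2))$. Circuit family: $\mathcal{C}=(C_n)_{n\ge0}$ is a (not necessarily uniform) family of Boolean circuits of size $n^k$ (some fixed $k$) and constant even depth $d$, in the normal form: input gates and negations of input gates are at level 0, all gates at odd levels are $\vee$, all gates at even levels $\ge2$ are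 $\wedge$, edges only go between consecutive levels; input gates are numbered $0,\dots,n-1$, negated inputs $n,\dots,2n-1$, and the $m$ output gates $n^k-m,\dots,n^k-1$. The set $\mathbf{circ}_{\mathcal{C}}=\{C,L_0^{in},L_0^{\neg},L_1,\dots,L_d,m\}$ consists of (characteristic functions of) predicates $L_0^{in},L_0^{\neg},L_e\subseteq\mathbb{N}^2$, $C\subseteq\mathbb{N}^3$ and a function $m:\mathbb{N}\to\mathbb{N}$ describing the family: $m(\ell(x))$ is the number of output gates of $C_{\ell(x)}$; $L_0^{in}(a,x)$, $L_0^{\neg}(a,x)$ describe the input gates and negated input gates of $C_{\ell(x)}$ on input $x$; $L_e(a,x)$ holds iff the $a$-th gate of $C_{\ell(x)}$ is at level $e$; $(x,a,b)\in C$ iff in $C_{\ell(x)}$ gate $a$ (at some level) is a predecessor of gate $b$ (at the next level), for $a,b\le\ell(x)^k$. $\mathbb{ACDL}_{\mathcal{C}}=[\mathbf{0},\mathbf{1},\mathbf{circ}_{\mathcal{C}},\mathrm{sg},\ell,+,-,\div2,\pi^p_i;\ \circ,\ \ell\text{ -ODE}_2,\ \ell\text{ -ODE}_3]$, the smallest class containing these basic functions (constants, projections) and closed under composition and the two schemas. -}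

module Defs where

open import Data.Nat using (ℕ; zero; suc; _+_; _*_; _∸_; _^_; _≤_; _<_; _/_; _%_; _≟_; _<?_; _≤?_)
open import Data.Nat.Logarithm using (⌈log₂_⌉)
open import Data.Bool using (Bool; true; false; if_then_else_; _∧_)
open import Data.Fin using (Fin)
open import Data.Vec using (Vec; []; _∷_; lookup)
open import Data.Maybe using (Maybe; just; nothing)
open import Data.Product using (_×_)
open import Relation.Nullary.Decidable using (⌊_⌋)
open import Relation.Binary.PropositionalEquality using (_≡_; _≢_)

ℓ : ℕ → ℕ
ℓ x = ⌈log₂ (suc x) ⌉

sg : ℕ → ℕ
sg zero    = 0
sg (suc _) = 1

half : ℕ → ℕ
half x = x / 2

χ : Bool → ℕ
χ true  = 1
χ false = 0

bit : ℕ → ℕ → ℕ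
bit zero    x = x % 2
bit (suc a) x = bit a (x / 2)

-- Circuit families (normal form of the paper)
-- C_n has gates 0 .. n^k - 1; gates 0..n-1 are the inputs, n..2n-1 the
-- negated inputs (level 0); the remaining gates are at levels 1..d
-- (odd levels: ∨, even levels ≥ 2: ∧, so the gate type is determined by
-- the level); edges go between consecutive levels; the m(n) output gates
-- are n^k - m(n) .. n^k - 1, at the top level d.

record CircuitFamily : Set where
  field
    k          : ℕ
    halfDepth  : ℕ
    outputs    : ℕ → ℕ
    level      : ℕ → ℕ → ℕ
    edge       : ℕ → ℕ → ℕ → Bool

  depth : ℕ
  depth = 2 * halfDepth

  field
    level-input    : ∀ n a → a < 2 * n → level n a ≡ 0
    level-internal : ∀ n a → 2 * n ≤ a → a < n ^ k → (1 ≤ level n a) × (level n a ≤ depth)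
    edge-ok        : ∀ n a b → edge n a b ≡ true →
                     (a < n ^ k) × (b < n ^ k) × (level n b ≡ suc (level n a))
    outputs-bound  : ∀ n → outputs n ≤ n ^ k
    outputs-level  : ∀ n a → n ^ k ∸ outputs n ≤ a → a < n ^ k → level n a ≡ depth

module Circ (𝒞 : CircuitFamily) where
  open CircuitFamily 𝒞

  circC : ℕ → ℕ → ℕ → ℕ
  circC x a b = χ (edge (ℓ x) a b)

  circL0in : ℕ → ℕ → ℕ
  circL0in a x = χ (⌊ a <? ℓ x ⌋ ∧ ⌊ bit a x ≟ 1 ⌋)

  circL0neg : ℕ → ℕ → ℕ
  circL0neg a x = χ (⌊ ℓ x ≤? a ⌋ ∧ ⌊ a <? 2 * ℓ x ⌋ ∧ ⌊ bit (a ∸ ℓ x) x ≟ 0 ⌋)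

  circL : ℕ → ℕ → ℕ → ℕ
  circL e a x = χ (⌊ a <? ℓ x ^ k ⌋ ∧ ⌊ level (ℓ x) a ≟ e ⌋)

  circm : ℕ → ℕ
  circm = outputs

-- Solutions of the two length-ODE schemas.
-- f(x+1, y) = f(x, y) + (ℓ(x+1) - ℓ(x)) · E(x, y)

-- ℓ-ODE₂ : f(0,y) = g(y),  ∂f/∂ℓ = (2^ℓ(k(y)) - 1) f(x,y) + h(x,y)
ode2 : ∀ {n} → (Vec ℕ n → ℕ) → (Vec ℕ (suc n) → ℕ) → (Vec ℕ n → ℕ) → Vec ℕ (suc n) → ℕ
ode2 g h k (zero ∷ y)  = g y
ode2 g h k (suc x ∷ y) =
  let f = ode2 g h k (x ∷ y) in
  f + (ℓ (suc x) ∸ ℓ x) * ((2 ^ ℓ (k y) ∸ 1) * f + h (x ∷ y))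

-- ℓ-ODE₃ : f(0,y) = g(y),  ∂f/∂ℓ = -(f(x,y) - (f(x,y) ÷ 2))
-- (the subtracted quantity never exceeds f, so truncated subtraction is exact)
ode3 : ∀ {n} → (Vec ℕ n → ℕ) → Vec ℕ (suc n) → ℕ
ode3 g (zero ∷ y)  = g y
ode3 g (suc x ∷ y) =
  let f = ode3 g (x ∷ y) in
  f ∸ (ℓ (suc x) ∸ ℓ x) * (f ∸ half f)

data ACDL (𝒞 : CircuitFamily) : (n : ℕ) → (Vec ℕ n → ℕ) → Set where
  zero′  : ACDL 𝒞 0 (λ _ → 0)
  one′   : ACDL 𝒞 0 (λ _ → 1)
  cC     : ACDL 𝒞 3 (λ { (x ∷ a ∷ b ∷ []) → Circ.circC 𝒞 x a b })
  cL0in  : ACDL 𝒞 2 (λ { (a ∷ x ∷ []) → Circ.circL0in 𝒞 a x })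
  cL0neg : ACDL 𝒞 2 (λ { (a ∷ x ∷ []) → Circ.circL0neg 𝒞 a x })
  cL     : (e : ℕ) → 1 ≤ e → e ≤ CircuitFamily.depth 𝒞 →
           ACDL 𝒞 2 (λ { (a ∷ x ∷ []) → Circ.circL 𝒞 e a x })
  cm     : ACDL 𝒞 1 (λ { (x ∷ []) → Circ.circm 𝒞 x })
  sg′    : ACDL 𝒞 1 (λ { (x ∷ []) → sg x })
  ℓ′     : ACDL 𝒞 1 (λ { (x ∷ []) → ℓ x })
  plus   : ACDL 𝒞 2 (λ { (x ∷ y ∷ []) → x + y })
  minus  : ACDL 𝒞 2 (λ { (x ∷ y ∷ []) → x ∸ y })
  half′  : ACDL 𝒞 1 (λ { (x ∷ []) → half x })
  proj   : ∀ {n} (i : Fin n) → ACDL 𝒞 n (λ v → lookup v i)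
  comp   : ∀ {n m} {h : Vec ℕ m → ℕ} {gs : Fin m → Vec ℕ n → ℕ} →
           ACDL 𝒞 m h → ((i : Fin m) → ACDL 𝒞 n (gs i)) →
           ACDL 𝒞 n (λ v → h (Data.Vec.tabulate (λ i → gs i v)))
  lode2  : ∀ {n} {g : Vec ℕ n → ℕ} {h : Vec ℕ (suc n) → ℕ} {k : Vec ℕ n → ℕ} →
           ACDL 𝒞 n g → ACDL 𝒞 (suc n) h → ACDL 𝒞 n k →
           (∀ z → h z ≤ 1) →
           (∀ x y → h (x ∷ y) ≡ 1 → k y ≢ 0) →
           ACDL 𝒞 (suc n) (ode2 g h k)
  lode3  : ∀ {n} {g : Vec ℕ n → ℕ} →
           ACDL 𝒞 n g → ACDL 𝒞 (suc n) (ode3 g)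
  ext    : ∀ {n} {f f′ : Vec ℕ n → ℕ} →
           ACDL 𝒞 n f → (∀ v → f v ≡ f′ v) → ACDL 𝒞 n f′

data Cmp : Set where
  lt le gt ge eq : Cmp

holds : Cmp → ℕ → ℕ → Bool
holds lt a b = ⌊ a <? b ⌋
holds le a b = ⌊ a ≤? b ⌋
holds gt a b = ⌊ b <? a ⌋
holds ge a b = ⌊ b ≤? a ⌋
holds eq a b = ⌊ a ≟ b ⌋

min? : Maybe ℕ → Maybe ℕ → Maybe ℕ
min? nothing  m        = m
min? (just a) nothing  = just a
min? (just a) (just b) = just (a Data.Nat.⊓ b)

bmin? : (ℕ → Bool) → (ℕ → ℕ) → ℕ → Maybe ℕ
bmin? P G zero    = if P 0 then just (G 0) else nothing
bmin? P G (suc B) = min? (bmin? P G B) (if P (suc B) then just (G (suc B)) else nothing)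

-- convention: the minimum over the empty set is 0
bmin : (ℕ → Bool) → (ℕ → ℕ) → ℕ → ℕ
bmin P G B with bmin? P G B
... | just v  = v
... | nothing = 0

boundedMin : ∀ {n} → (Vec ℕ (suc (suc n)) → ℕ) → (Vec ℕ (suc (suc n)) → ℕ) →
             Cmp → ℕ → ℕ → Vec ℕ (suc n) → ℕ
boundedMin g h ▷ j k x⃗@(x₁ ∷ _) =
  bmin (λ i → holds ▷ (h (i ∷ x⃗)) j) (λ i → g (i ∷ x⃗)) (ℓ x₁ ^ k)

{-# OPTIONS --safe #-}

-- Bounded minimisation is computed by reading binary numerals through ℓ. The homogeneous
-- ℓ-ODE₂ yields a·2^(ℓ c · ℓ x); with multiplier 2^ℓ(1) − 1 = 1 and a 0/1 forcing term
-- H (ℓ x, …) it builds the numeral whose t-th binary digit is H t, one digit each time ℓ x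
-- grows. Use L = B + 1 = ℓ (2·(x₁ #^ k) + 1) digits, where ℓ (x # y) = ℓ x · ℓ y.
-- An index i ≤ B is a minimiser iff P i holds and the numeral with digits [P t ∧ G t < G i]
-- is 0. The numeral M whose t-th digit says "t is a minimiser" is 0 iff no i ≤ B satisfies
-- P; otherwise its leading digit is a minimiser t with t + ℓ M = L, so the minimum is
-- sg M · G (L ∸ ℓ M).

module Submission where

open import Data.Bool using (Bool; true; false; _∧_)
open import Data.Bool.Properties using (not-¬)
open import Data.Fin using (Fin; zero; suc)
open import Data.Maybe using (Maybe; just; nothing)
open import Data.Nat
open import Data.Nat.Logarithm
open import Data.Nat.Properties
open import Data.Product using (_×_; _,_; ∃; ∃-syntax)
open import Data.Sum using (_⊎_; inj₁; inj₂; [_,_]′)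
open import Data.Vec using (Vec; []; _∷_; head; tail; tabulate; lookup)
open import Data.Vec.Properties using (tabulate∘lookup)
open import Function using (_∘_)
open import Relation.Binary.Definitions using (tri<; tri≈; tri>)
open import Relation.Binary.PropositionalEquality
open import Relation.Nullary using (Dec; yes; no; ¬_; contradiction)
open import Relation.Nullary.Decidable using (⌊_⌋)

open import Algebra.Properties.CommutativeSemigroup *-commutativeSemigroup using (x∙yz≈y∙xz)

open import Defs

ℓ-mono-≤ : ∀ {m n} → m ≤ n → ℓ m ≤ ℓ n
ℓ-mono-≤ m≤n = ⌈log₂⌉-mono-≤ (s≤s m≤n)

ℓ[2n+1] : ∀ n → ℓ (2 * n + 1) ≡ suc (ℓ n)
ℓ[2n+1] n = begin
  ⌈log₂ (suc (2 * n + 1)) ⌉ ≡⟨ cong ⌈log₂_⌉ (trans (cong suc (+-comm (2 * n) 1)) (sym (*-suc 2 n))) ⟩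
  ⌈log₂ (2 * suc n) ⌉       ≡⟨ ⌈log₂2*n⌉≡1+⌈log₂n⌉ (suc n) ⟩
  suc (ℓ n)                 ∎
  where open ≡-Reasoning

ℓ[2n] : ∀ n .{{_ : NonZero n}} → ℓ (2 * n) ≡ suc (ℓ n)
ℓ[2n] n = begin
  ℓ (2 * n)                     ≡⟨ m+[n∸m]≡n 1≤ℓ[2n] ⟨
  suc (ℓ (2 * n) ∸ 1)           ≡⟨ cong suc (⌈log₂⌈n/2⌉⌉≡⌈log₂n⌉∸1 (suc (2 * n))) ⟨
  suc ⌈log₂ ⌈ suc (2 * n) /2⌉ ⌉ ≡⟨ cong (λ m → suc (ℓ m)) half-double ⟩
  suc (ℓ n)                     ∎
  where
  open ≡-Reasoning
  1≤ℓ[2n] : 1 ≤ ℓ (2 * n)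
  1≤ℓ[2n] = ℓ-mono-≤ {1} (≤-trans (>-nonZero⁻¹ n) (m≤n*m n 2))
  half-double : ⌊ 2 * n /2⌋ ≡ n
  half-double = sym (trans (n≡⌊n+n/2⌋ n) (cong (λ m → ⌊ n + m /2⌋) (sym (+-identityʳ n))))

ℓ-suc : ∀ n → ℓ (suc n) ≡ ℓ n ⊎ ℓ (suc n) ≡ suc (ℓ n)
ℓ-suc n with m≤n⇒m<n∨m≡n (ℓ-mono-≤ (n≤1+n n))
... | inj₂ ℓn≡ℓ[1+n] = inj₁ (sym ℓn≡ℓ[1+n])
... | inj₁ ℓn<ℓ[1+n] = inj₂ (≤-antisym ℓ[1+n]≤1+ℓn ℓn<ℓ[1+n])
  where
  1+n≤2n+1 : suc n ≤ 2 * n + 1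
  1+n≤2n+1 = subst (_≤ 2 * n + 1) (+-comm n 1) (+-monoˡ-≤ 1 (m≤n*m n 2))
  ℓ[1+n]≤1+ℓn : ℓ (suc n) ≤ suc (ℓ n)
  ℓ[1+n]≤1+ℓn = subst (ℓ (suc n) ≤_) (ℓ[2n+1] n) (ℓ-mono-≤ 1+n≤2n+1)

ℓ[2^n∸1] : ∀ n → ℓ (2 ^ n ∸ 1) ≡ n
ℓ[2^n∸1] n = trans (cong ⌈log₂_⌉ (m+[n∸m]≡n (m^n>0 2 n))) (⌈log₂2^n⌉≡n n)

affineSeq : ℕ → ℕ → (ℕ → ℕ) → ℕ → ℕ
affineSeq c u₀ H zero    = u₀
affineSeq c u₀ H (suc t) = affineSeq c u₀ H t + (c * affineSeq c u₀ H t + H t)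

affineSeq-step : ∀ c u₀ H {a b} → b ≡ a ⊎ b ≡ suc a →
  affineSeq c u₀ H a + (b ∸ a) * (c * affineSeq c u₀ H a + H a) ≡ affineSeq c u₀ H b
affineSeq-step c u₀ H {a} (inj₁ refl) = begin
  u + (a ∸ a) * d ≡⟨ cong (λ z → u + z * d) (n∸n≡0 a) ⟩
  u + 0           ≡⟨ +-identityʳ u ⟩
  u               ∎
  where
  open ≡-Reasoning
  u = affineSeq c u₀ H a
  d = c * u + H a
affineSeq-step c u₀ H {a} (inj₂ refl) = cong (u +_) (begin
  (suc a ∸ a) * d ≡⟨ cong (_* d) (m+n∸n≡m 1 a) ⟩
  1 * d           ≡⟨ *-identityˡ d ⟩
  d               ∎)
  where
  open ≡-Reasoning
  u = affineSeq c u₀ H a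
  d = c * u + H a

ode2≡affineSeq : ∀ {m} (g : Vec ℕ m → ℕ) h k y (H : ℕ → ℕ) → (∀ x → h (x ∷ y) ≡ H (ℓ x)) →
  ∀ x → ode2 g h k (x ∷ y) ≡ affineSeq (2 ^ ℓ (k y) ∸ 1) (g y) H (ℓ x)
ode2≡affineSeq g h k y H h≡H zero    = refl
ode2≡affineSeq g h k y H h≡H (suc x) = begin
  f + (ℓ (suc x) ∸ ℓ x) * (c * f + h (x ∷ y))
    ≡⟨ cong₂ (λ u v → u + (ℓ (suc x) ∸ ℓ x) * (c * u + v)) (ode2≡affineSeq g h k y H h≡H x) (h≡H x) ⟩
  u (ℓ x) + (ℓ (suc x) ∸ ℓ x) * (c * u (ℓ x) + H (ℓ x))
    ≡⟨ affineSeq-step c (g y) H (ℓ-suc x) ⟩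
  u (ℓ (suc x)) ∎
  where
  open ≡-Reasoning
  c = 2 ^ ℓ (k y) ∸ 1
  f = ode2 g h k (x ∷ y)
  u = affineSeq c (g y) H

affineSeq-homogeneous : ∀ m u₀ t → affineSeq (2 ^ m ∸ 1) u₀ (λ _ → 0) t ≡ u₀ * 2 ^ (m * t)
affineSeq-homogeneous m u₀ zero = begin
  u₀                ≡⟨ *-identityʳ u₀ ⟨
  u₀ * 1            ≡⟨ cong (λ e → u₀ * 2 ^ e) (*-zeroʳ m) ⟨
  u₀ * 2 ^ (m * 0)  ∎
  where open ≡-Reasoning
affineSeq-homogeneous m u₀ (suc t) = begin
  u + ((2 ^ m ∸ 1) * u + 0)  ≡⟨ cong (u +_) (+-identityʳ _) ⟩
  u + (2 ^ m ∸ 1) * u        ≡⟨ cong (_+ (2 ^ m ∸ 1) * u) (*-identityˡ u) ⟨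
  1 * u + (2 ^ m ∸ 1) * u    ≡⟨ *-distribʳ-+ u 1 (2 ^ m ∸ 1) ⟨
  (1 + (2 ^ m ∸ 1)) * u      ≡⟨ cong (_* u) (m+[n∸m]≡n (m^n>0 2 m)) ⟩
  2 ^ m * u                  ≡⟨ cong (2 ^ m *_) (affineSeq-homogeneous m u₀ t) ⟩
  2 ^ m * (u₀ * 2 ^ (m * t)) ≡⟨ x∙yz≈y∙xz (2 ^ m) u₀ _ ⟩
  u₀ * (2 ^ m * 2 ^ (m * t)) ≡⟨ cong (u₀ *_) (^-distribˡ-+-* 2 m (m * t)) ⟨
  u₀ * 2 ^ (m + m * t)       ≡⟨ cong (λ e → u₀ * 2 ^ e) (*-suc m t) ⟨
  u₀ * 2 ^ (m * suc t)       ∎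
  where
  open ≡-Reasoning
  u = affineSeq (2 ^ m ∸ 1) u₀ (λ _ → 0) t

-- bin H L is the numeral with binary digits H 0, …, H (L ∸ 1), most significant first
bin : (ℕ → ℕ) → ℕ → ℕ
bin = affineSeq 1 0

bin-suc : ∀ H L → bin H (suc L) ≡ 2 * bin H L + H L
bin-suc H L = sym (+-assoc (bin H L) (bin H L + 0) (H L))

bin≡0⇒digit≡0 : ∀ H L → bin H L ≡ 0 → ∀ {t} → t < L → H t ≡ 0
bin≡0⇒digit≡0 H (suc L) bin≡0 t<1+L with m<1+n⇒m<n∨m≡n t<1+L
... | inj₁ t<L  = bin≡0⇒digit≡0 H L (m+n≡0⇒m≡0 (bin H L) bin≡0) t<L
... | inj₂ refl = m+n≡0⇒n≡0 (2 * bin H L) (trans (sym (bin-suc H L)) bin≡0)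

digits≡0⇒bin≡0 : ∀ H L → (∀ {t} → t < L → H t ≡ 0) → bin H L ≡ 0
digits≡0⇒bin≡0 H zero    _    = refl
digits≡0⇒bin≡0 H (suc L) H≡0 =
  cong₂ (λ b d → b + (1 * b + d)) (digits≡0⇒bin≡0 H L (λ t<L → H≡0 (m<n⇒m<1+n t<L))) (H≡0 (n<1+n L))

bin-leading-digit : ∀ H → (∀ t → H t ≤ 1) → ∀ L → bin H L ≢ 0 →
  ∃[ t ] t < L × H t ≡ 1 × t + ℓ (bin H L) ≡ L
bin-leading-digit H H≤1 zero bin≢0 = contradiction refl bin≢0
bin-leading-digit H H≤1 (suc L) bin≢0 with bin H L ≟ 0
... | yes b≡0 = L , n<1+n L , H[L]≡1 , (begin
  L + ℓ (bin H (suc L)) ≡⟨ cong (λ m → L + ℓ m) (trans (bin-suc H L) (cong (λ b → 2 * b + H L) b≡0)) ⟩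
  L + ℓ (H L)           ≡⟨ cong (λ m → L + ℓ m) H[L]≡1 ⟩
  L + 1                 ≡⟨ +-comm L 1 ⟩
  suc L                 ∎)
  where
  open ≡-Reasoning
  H[L]≡1 : H L ≡ 1
  H[L]≡1 with H L | H≤1 L | bin-suc H L
  ... | 0    | _       | bin≡ = contradiction (trans bin≡ (cong (λ b → 2 * b + 0) b≡0)) bin≢0
  ... | 1    | _       | _    = refl
  ... | 2+ _ | s≤s ()  | _
... | no b≢0 with bin-leading-digit H H≤1 L b≢0
...   | t , t<L , H[t]≡1 , t+ℓ≡L = t , m<n⇒m<1+n t<L , H[t]≡1 , (begin
  t + ℓ (bin H (suc L))   ≡⟨ cong (λ m → t + ℓ m) (bin-suc H L) ⟩
  t + ℓ (2 * b + H L)     ≡⟨ cong (t +_) (ℓ[2b+d] (H L) (H≤1 L)) ⟩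
  t + suc (ℓ b)           ≡⟨ +-suc t (ℓ b) ⟩
  suc (t + ℓ b)           ≡⟨ cong suc t+ℓ≡L ⟩
  suc L                   ∎)
  where
  open ≡-Reasoning
  b = bin H L
  instance _ = ≢-nonZero b≢0
  ℓ[2b+d] : ∀ d → d ≤ 1 → ℓ (2 * b + d) ≡ suc (ℓ b)
  ℓ[2b+d] 0 _ = trans (cong ℓ (+-identityʳ (2 * b))) (ℓ[2n] b)
  ℓ[2b+d] 1 _ = ℓ[2n+1] b
  ℓ[2b+d] (2+ _) (s≤s ())

χ≤1 : ∀ b → χ b ≤ 1
χ≤1 false = z≤n
χ≤1 true  = ≤-refl

χ⌊⌋-yes : ∀ {A : Set} (a? : Dec A) → A → χ ⌊ a? ⌋ ≡ 1
χ⌊⌋-yes (yes _) _  = refl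
χ⌊⌋-yes (no ¬a) a = contradiction a ¬a

χ⌊⌋-no : ∀ {A : Set} (a? : Dec A) → ¬ A → χ ⌊ a? ⌋ ≡ 0
χ⌊⌋-no (yes a) ¬a = contradiction a ¬a
χ⌊⌋-no (no _)  _  = refl

χ∸sg≡1 : ∀ b n → χ b ∸ sg n ≡ 1 → b ≡ true × n ≡ 0
χ∸sg≡1 true  zero    _ = refl , refl
χ∸sg≡1 true  (suc _) ()
χ∸sg≡1 false zero    ()
χ∸sg≡1 false (suc _) ()

sg≢0 : ∀ {n} → n ≢ 0 → sg n ≡ 1
sg≢0 {zero}  n≢0 = contradiction refl n≢0
sg≢0 {suc _} _   = refl

χ[m≤n] : ∀ m n → χ ⌊ m ≤? n ⌋ ≡ 1 ∸ χ ⌊ n <? m ⌋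
χ[m≤n] m n with ≤-<-connex m n
... | inj₁ m≤n = trans (χ⌊⌋-yes (m ≤? n) m≤n) (sym (cong (1 ∸_) (χ⌊⌋-no (n <? m) (≤⇒≯ m≤n))))
... | inj₂ n<m = trans (χ⌊⌋-no (m ≤? n) (<⇒≱ n<m)) (sym (cong (1 ∸_) (χ⌊⌋-yes (n <? m) n<m)))

χ[m≡n] : ∀ m n → χ ⌊ m ≟ n ⌋ ≡ χ ⌊ m ≤? n ⌋ ∸ χ ⌊ m <? n ⌋
χ[m≡n] m n with <-cmp m n
... | tri< m<n m≢n _ = trans (χ⌊⌋-no (m ≟ n) m≢n)
  (sym (cong₂ _∸_ (χ⌊⌋-yes (m ≤? n) (<⇒≤ m<n)) (χ⌊⌋-yes (m <? n) m<n)))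
... | tri≈ m≮n m≡n _ = trans (χ⌊⌋-yes (m ≟ n) m≡n)
  (sym (cong₂ _∸_ (χ⌊⌋-yes (m ≤? n) (≤-reflexive m≡n)) (χ⌊⌋-no (m <? n) m≮n)))
... | tri> m≮n m≢n n<m = trans (χ⌊⌋-no (m ≟ n) m≢n)
  (sym (cong₂ _∸_ (χ⌊⌋-no (m ≤? n) (<⇒≱ n<m)) (χ⌊⌋-no (m <? n) m≮n)))

sg[m∸n]≡χ[n<m] : ∀ m n → sg (m ∸ n) ≡ χ ⌊ n <? m ⌋
sg[m∸n]≡χ[n<m] m n with ≤-<-connex m n
... | inj₁ m≤n = trans (cong sg (m≤n⇒m∸n≡0 m≤n)) (sym (χ⌊⌋-no (n <? m) (≤⇒≯ m≤n)))
... | inj₂ n<m = trans (sg≢0 (m>n⇒m∸n≢0 n<m)) (sym (χ⌊⌋-yes (n <? m) n<m))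

≤-suc-cases : ∀ {m n} → m ≤ suc n → m ≤ n ⊎ m ≡ suc n
≤-suc-cases m≤1+n with m≤n⇒m<n∨m≡n m≤1+n
... | inj₁ m<1+n = inj₁ (m<1+n⇒m≤n m<1+n)
... | inj₂ m≡1+n = inj₂ m≡1+n

Minimiser : (ℕ → Bool) → (ℕ → ℕ) → ℕ → ℕ → Set
Minimiser P G B i = i ≤ B × P i ≡ true × (∀ {t} → t ≤ B → P t ≡ true → G i ≤ G t)

data BMinView (P : ℕ → Bool) (G : ℕ → ℕ) (B : ℕ) : Maybe ℕ → Set where
  none : (∀ {i} → i ≤ B → P i ≡ false) → BMinView P G B nothing
  some : ∀ {i} → Minimiser P G B i → BMinView P G B (just (G i))

minimality-suc : ∀ {P : ℕ → Bool} {G : ℕ → ℕ} {B m} →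
  (∀ {t} → t ≤ B → P t ≡ true → m ≤ G t) → (P (suc B) ≡ true → m ≤ G (suc B)) →
  ∀ {t} → t ≤ suc B → P t ≡ true → m ≤ G t
minimality-suc below top t≤1+B with ≤-suc-cases t≤1+B
... | inj₁ t≤B = below t≤B
... | inj₂ refl = top

bmin?-view : ∀ P G B → BMinView P G B (bmin? P G B)
bmin?-view P G zero with P 0 in P[0]
... | true  = some (z≤n , P[0] , λ { z≤n _ → ≤-refl })
... | false = none λ { z≤n → P[0] }
bmin?-view P G (suc B) with bmin? P G B | bmin?-view P G B | P (suc B) in P[1+B]
... | nothing | none none≤B | false =
  none λ i≤1+B → [ none≤B , (λ { refl → P[1+B] }) ]′ (≤-suc-cases i≤1+B)
... | nothing | none none≤B | true  =
  some (≤-refl , P[1+B] , minimality-suc {G = G}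
    (λ t≤B P[t] → contradiction P[t] (not-¬ (none≤B t≤B))) (λ _ → ≤-refl))
... | just _  | some (i≤B , P[i] , min) | false =
  some (m≤n⇒m≤1+n i≤B , P[i] , minimality-suc min (λ P[1+B]′ → contradiction P[1+B]′ (not-¬ P[1+B])))
... | just _  | some {i} (i≤B , P[i] , min) | true with G i ≤? G (suc B)
...   | yes G[i]≤G[1+B] = subst (BMinView P G (suc B) ∘ just) (sym (m≤n⇒m⊓n≡m G[i]≤G[1+B]))
        (some (m≤n⇒m≤1+n i≤B , P[i] , minimality-suc min (λ _ → G[i]≤G[1+B])))
...   | no  G[i]≰G[1+B] = subst (BMinView P G (suc B) ∘ just) (sym (m≥n⇒m⊓n≡n (≰⇒≥ G[i]≰G[1+B])))
        (some (≤-refl , P[1+B] , minimality-suc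
          (λ t≤B P[t] → ≤-trans (≰⇒≥ G[i]≰G[1+B]) (min t≤B P[t])) (λ _ → ≤-refl)))

bmin-empty : ∀ P G B → (∀ {i} → i ≤ B → P i ≡ false) → bmin P G B ≡ 0
bmin-empty P G B none≤B with bmin? P G B | bmin?-view P G B
... | nothing | none _                = refl
... | just _  | some (i≤B , P[i] , _) = contradiction P[i] (not-¬ (none≤B i≤B))

bmin-minimiser : ∀ P G B {i} → Minimiser P G B i → bmin P G B ≡ G i
bmin-minimiser P G B (i≤B , P[i] , min) with bmin? P G B | bmin?-view P G B
... | nothing | none none≤B                = contradiction P[i] (not-¬ (none≤B i≤B))
... | just _  | some (i′≤B , P[i′] , min′) = ≤-antisym (min′ i≤B P[i]) (min i′≤B P[i′])

minimiser-or-empty : ∀ P G B → ∃ (Minimiser P G B) ⊎ (∀ {i} → i ≤ B → P i ≡ false)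
minimiser-or-empty P G B with bmin? P G B | bmin?-view P G B
... | nothing | none none≤B = inj₂ none≤B
... | just _  | some min    = inj₁ (_ , min)

undercut : (ℕ → Bool) → (ℕ → ℕ) → ℕ → ℕ → ℕ
undercut P G L i = bin (λ t → χ (P t ∧ ⌊ G t <? G i ⌋)) L

minimiserDigit : (ℕ → Bool) → (ℕ → ℕ) → ℕ → ℕ → ℕ
minimiserDigit P G L i = χ (P i) ∸ sg (undercut P G L i)

minimisers : (ℕ → Bool) → (ℕ → ℕ) → ℕ → ℕ
minimisers P G L = bin (minimiserDigit P G L) L

searchMin : (ℕ → Bool) → (ℕ → ℕ) → ℕ → ℕ
searchMin P G L = sg (minimisers P G L) * G (L ∸ ℓ (minimisers P G L))

minimiserDigit≤1 : ∀ P G L i → minimiserDigit P G L i ≤ 1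
minimiserDigit≤1 P G L i = ≤-trans (m∸n≤m (χ (P i)) (sg (undercut P G L i))) (χ≤1 (P i))

module _ (P : ℕ → Bool) (G : ℕ → ℕ) (B : ℕ) where

  minimiser⇒digit≡1 : ∀ {i} → Minimiser P G B i → minimiserDigit P G (suc B) i ≡ 1
  minimiser⇒digit≡1 {i} (_ , P[i] , min) = cong₂ (λ b n → χ b ∸ sg n) P[i]
    (digits≡0⇒bin≡0 _ (suc B) (λ t<1+B → not-undercut (m<1+n⇒m≤n t<1+B)))
    where
    not-undercut : ∀ {t} → t ≤ B → χ (P t ∧ ⌊ G t <? G i ⌋) ≡ 0
    not-undercut {t} t≤B with P t in P[t]
    ... | false = refl
    ... | true  = χ⌊⌋-no (G t <? G i) (≤⇒≯ (min t≤B P[t]))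

  digit≡1⇒minimiser : ∀ {i} → i ≤ B → minimiserDigit P G (suc B) i ≡ 1 → Minimiser P G B i
  digit≡1⇒minimiser {i} i≤B digit≡1 with χ∸sg≡1 (P i) (undercut P G (suc B) i) digit≡1
  ... | P[i] , undercut≡0 = i≤B , P[i] , min
    where
    min : ∀ {t} → t ≤ B → P t ≡ true → G i ≤ G t
    min {t} t≤B P[t] = ≮⇒≥ λ G[t]<G[i] → 1+n≢0 (begin
      1                                ≡⟨ χ⌊⌋-yes (G t <? G i) G[t]<G[i] ⟨
      χ ⌊ G t <? G i ⌋                 ≡⟨ cong (λ b → χ (b ∧ ⌊ G t <? G i ⌋)) P[t] ⟨
      χ (P t ∧ ⌊ G t <? G i ⌋)         ≡⟨ bin≡0⇒digit≡0 _ (suc B) undercut≡0 (s≤s t≤B) ⟩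
      0                                ∎)
      where open ≡-Reasoning

  minimisers≢0 : ∀ {i} → Minimiser P G B i → minimisers P G (suc B) ≢ 0
  minimisers≢0 minimiser@(i≤B , _) M≡0 =
    1+n≢0 (trans (sym (minimiser⇒digit≡1 minimiser)) (bin≡0⇒digit≡0 _ (suc B) M≡0 (s≤s i≤B)))

  bmin≡searchMin : bmin P G B ≡ searchMin P G (suc B)
  bmin≡searchMin with minimiser-or-empty P G B
  ... | inj₂ none≤B = begin
    bmin P G B             ≡⟨ bmin-empty P G B none≤B ⟩
    0                      ≡⟨ cong (λ M → sg M * G (suc B ∸ ℓ M)) M≡0 ⟨
    searchMin P G (suc B)  ∎
    where
    open ≡-Reasoning
    M≡0 : minimisers P G (suc B) ≡ 0
    M≡0 = digits≡0⇒bin≡0 _ (suc B) (λ t<1+B → non-minimiser (m<1+n⇒m≤n t<1+B))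
      where
      non-minimiser : ∀ {t} → t ≤ B → minimiserDigit P G (suc B) t ≡ 0
      non-minimiser {t} t≤B = trans (cong (λ b → χ b ∸ sg (undercut P G (suc B) t)) (none≤B t≤B))
        (0∸n≡0 (sg (undercut P G (suc B) t)))
  ... | inj₁ (_ , minimiser) with bin-leading-digit _ (minimiserDigit≤1 P G (suc B)) (suc B) (minimisers≢0 minimiser)
  ... | t , t<1+B , digit[t]≡1 , t+ℓM≡1+B = begin
    bmin P G B            ≡⟨ bmin-minimiser P G B (digit≡1⇒minimiser (m<1+n⇒m≤n t<1+B) digit[t]≡1) ⟩
    G t                   ≡⟨ cong G (m+n∸n≡m t (ℓ M)) ⟨
    G (t + ℓ M ∸ ℓ M)     ≡⟨ cong (λ L → G (L ∸ ℓ M)) t+ℓM≡1+B ⟩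
    G (suc B ∸ ℓ M)       ≡⟨ *-identityˡ _ ⟨
    1 * G (suc B ∸ ℓ M)   ≡⟨ cong (_* G (suc B ∸ ℓ M)) (sg≢0 (minimisers≢0 minimiser)) ⟨
    searchMin P G (suc B) ∎
    where
    open ≡-Reasoning
    M = minimisers P G (suc B)

_#_ : ℕ → ℕ → ℕ
x # y = 2 ^ (ℓ x * ℓ y) ∸ 1

ℓ-# : ∀ x y → ℓ (x # y) ≡ ℓ x * ℓ y
ℓ-# x y = ℓ[2^n∸1] (ℓ x * ℓ y)

_#^_ : ℕ → ℕ → ℕ
x #^ zero  = 1
x #^ suc k = x # (x #^ k)

ℓ-#^ : ∀ x k → ℓ (x #^ k) ≡ ℓ x ^ k
ℓ-#^ x zero    = refl
ℓ-#^ x (suc k) = trans (ℓ-# x (x #^ k)) (cong (ℓ x *_) (ℓ-#^ x k))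

module _ {𝒞 : CircuitFamily} where

  ap₁ : ∀ {n f} {a : Vec ℕ n → ℕ} → ACDL 𝒞 1 f → ACDL 𝒞 n a → ACDL 𝒞 n (λ v → f (a v ∷ []))
  ap₁ {a = a} fᶜ aᶜ = comp {gs = λ _ → a} fᶜ (λ _ → aᶜ)

  ap₂ : ∀ {n f} {a b : Vec ℕ n → ℕ} → ACDL 𝒞 2 f → ACDL 𝒞 n a → ACDL 𝒞 n b →
        ACDL 𝒞 n (λ v → f (a v ∷ b v ∷ []))
  ap₂ {a = a} {b} fᶜ aᶜ bᶜ = comp {gs = args} fᶜ λ { zero → aᶜ ; (suc zero) → bᶜ }
    where
    args : Fin 2 → Vec ℕ _ → ℕ
    args zero       = a
    args (suc zero) = b

  const : ∀ {n} c → ACDL 𝒞 n (λ _ → c)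
  const zero    = comp {gs = λ ()} zero′ λ ()
  const (suc c) = ap₂ plus (comp {gs = λ ()} one′ λ ()) (const c)

  rename : ∀ {m n f} (ρ : Fin m → Fin n) → ACDL 𝒞 m f → ACDL 𝒞 n (λ v → f (tabulate (lookup v ∘ ρ)))
  rename ρ fᶜ = comp {gs = λ i v → lookup v (ρ i)} fᶜ (proj ∘ ρ)

  weaken : ∀ {m f} → ACDL 𝒞 m f → ACDL 𝒞 (suc m) (f ∘ tail)
  weaken {f = f} fᶜ = ext (rename suc fᶜ) λ { (_ ∷ v) → cong f (tabulate∘lookup v) }

  weaken₁ : ∀ {m f} → ACDL 𝒞 (suc m) f → ACDL 𝒞 (suc (suc m)) (λ w → f (head w ∷ tail (tail w)))
  weaken₁ {f = f} fᶜ = ext (rename skip₁ fᶜ) λ { (x ∷ _ ∷ v) → cong (f ∘ (x ∷_)) (tabulate∘lookup v) }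
    where
    skip₁ : ∀ {m} → Fin (suc m) → Fin (suc (suc m))
    skip₁ zero    = zero
    skip₁ (suc i) = suc (suc i)

  subst₀ : ∀ {m f} {a : Vec ℕ m → ℕ} → ACDL 𝒞 m a → ACDL 𝒞 (suc m) f → ACDL 𝒞 m (λ v → f (a v ∷ v))
  subst₀ {m} {f} {a} aᶜ fᶜ = ext (comp {gs = args} fᶜ λ { zero → aᶜ ; (suc i) → proj i })
    λ v → cong (f ∘ (a v ∷_)) (tabulate∘lookup v)
    where
    args : Fin (suc m) → Vec ℕ m → ℕ
    args zero    = a
    args (suc i) = λ v → lookup v i

  ℓ-head : ∀ {m f} → ACDL 𝒞 (suc m) f → ACDL 𝒞 (suc m) (λ w → f (ℓ (head w) ∷ tail w))
  ℓ-head fᶜ = ext (subst₀ (ap₁ ℓ′ (proj zero)) (weaken₁ fᶜ)) λ { (_ ∷ _) → refl }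

  shift-closed : ∀ {n} {a c : Vec ℕ n → ℕ} → ACDL 𝒞 n a → ACDL 𝒞 n c →
                 ACDL 𝒞 (suc n) (λ w → a (tail w) * 2 ^ (ℓ (c (tail w)) * ℓ (head w)))
  shift-closed {a = a} {c} aᶜ cᶜ = ext (lode2 aᶜ (const 0) cᶜ (λ _ → z≤n) (λ _ _ ())) λ { (x ∷ y) →
    trans (ode2≡affineSeq _ _ _ y (λ _ → 0) (λ _ → refl) x) (affineSeq-homogeneous (ℓ (c y)) (a y) (ℓ x)) }

  #-closed : ∀ {n} {a b : Vec ℕ n → ℕ} → ACDL 𝒞 n a → ACDL 𝒞 n b → ACDL 𝒞 n (λ v → a v # b v)
  #-closed {a = a} {b} aᶜ bᶜ = ext (ap₂ minus (subst₀ bᶜ (shift-closed (const 1) aᶜ)) (const 1))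
    λ v → cong (_∸ 1) (*-identityˡ (2 ^ (ℓ (a v) * ℓ (b v))))

  #^-closed : ∀ {n} {a : Vec ℕ n → ℕ} k → ACDL 𝒞 n a → ACDL 𝒞 n (λ v → a v #^ k)
  #^-closed zero    aᶜ = const 1
  #^-closed (suc k) aᶜ = #-closed aᶜ (#^-closed k aᶜ)

  sg*-closed : ∀ {n} {a b : Vec ℕ n → ℕ} → ACDL 𝒞 n a → ACDL 𝒞 n b → ACDL 𝒞 n (λ v → sg (a v) * b v)
  sg*-closed {a = a} {b} aᶜ bᶜ =
    ext (ap₂ minus (subst₀ (ap₁ sg′ aᶜ) (shift-closed bᶜ (const 1))) bᶜ) λ v → shift-by-sg (a v) (b v)
    where
    shift-by-sg : ∀ x y → y * 2 ^ (ℓ 1 * ℓ (sg x)) ∸ y ≡ sg x * y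
    shift-by-sg zero    y = trans (cong (_∸ y) (*-identityʳ y)) (n∸n≡0 y)
    shift-by-sg (suc _) y = begin
      y * 2 ∸ y       ≡⟨ cong (_∸ y) (*-comm y 2) ⟩
      y + (y + 0) ∸ y ≡⟨ m+n∸m≡n y (y + 0) ⟩
      y + 0           ∎
      where open ≡-Reasoning

  bin-closed : ∀ {n} {len : Vec ℕ n → ℕ} {H : Vec ℕ (suc n) → ℕ} →
               ACDL 𝒞 n len → ACDL 𝒞 (suc n) H → (∀ w → H w ≤ 1) →
               ACDL 𝒞 n (λ v → bin (λ t → H (t ∷ v)) (ℓ (len v)))
  bin-closed {n} {H = H} lenᶜ Hᶜ H≤1 = subst₀ lenᶜ binᶜ
    where
    binᶜ : ACDL 𝒞 (suc n) (λ w → bin (λ t → H (t ∷ tail w)) (ℓ (head w)))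
    binᶜ = ext (lode2 (const 0) (ℓ-head Hᶜ) (const 1) (λ _ → H≤1 _) (λ _ _ _ ())) λ { (x ∷ y) →
      ode2≡affineSeq _ (λ w → H (ℓ (head w) ∷ tail w)) _ y (λ t → H (t ∷ y)) (λ _ → refl) x }

  <-closed : ∀ {n} {a b : Vec ℕ n → ℕ} → ACDL 𝒞 n a → ACDL 𝒞 n b →
             ACDL 𝒞 n (λ v → χ ⌊ a v <? b v ⌋)
  <-closed {a = a} {b} aᶜ bᶜ = ext (ap₁ sg′ (ap₂ minus bᶜ aᶜ)) λ v → sg[m∸n]≡χ[n<m] (b v) (a v)

  ∧-closed : ∀ {n} {p q : Vec ℕ n → Bool} → ACDL 𝒞 n (χ ∘ p) → ACDL 𝒞 n (χ ∘ q) →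
             ACDL 𝒞 n (λ v → χ (p v ∧ q v))
  ∧-closed {p = p} {q} pᶜ qᶜ = ext (ap₂ minus pᶜ (ap₂ minus (const 1) qᶜ)) λ v → χ∸[1∸χ] (p v) (q v)
    where
    χ∸[1∸χ] : ∀ x y → χ x ∸ (1 ∸ χ y) ≡ χ (x ∧ y)
    χ∸[1∸χ] false false = refl
    χ∸[1∸χ] false true  = refl
    χ∸[1∸χ] true  false = refl
    χ∸[1∸χ] true  true  = refl

  holds-closed : ∀ {n} {a b : Vec ℕ n → ℕ} ▷ → ACDL 𝒞 n a → ACDL 𝒞 n b →
                 ACDL 𝒞 n (λ v → χ (holds ▷ (a v) (b v)))
  holds-closed lt aᶜ bᶜ = <-closed aᶜ bᶜ
  holds-closed gt aᶜ bᶜ = <-closed bᶜ aᶜ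
  holds-closed {a = a} {b} le aᶜ bᶜ = ext (ap₂ minus (const 1) (<-closed bᶜ aᶜ)) λ v → sym (χ[m≤n] (a v) (b v))
  holds-closed {a = a} {b} ge aᶜ bᶜ = ext (ap₂ minus (const 1) (<-closed aᶜ bᶜ)) λ v → sym (χ[m≤n] (b v) (a v))
  holds-closed {a = a} {b} eq aᶜ bᶜ =
    ext (ap₂ minus (holds-closed le aᶜ bᶜ) (<-closed aᶜ bᶜ)) λ v → sym (χ[m≡n] (a v) (b v))

  searchMin-closed : ∀ {n} {len : Vec ℕ n → ℕ} {P : Vec ℕ (suc n) → Bool} {G : Vec ℕ (suc n) → ℕ} →
    ACDL 𝒞 n len → ACDL 𝒞 (suc n) (χ ∘ P) → ACDL 𝒞 (suc n) G →
    ACDL 𝒞 n (λ v → searchMin (λ i → P (i ∷ v)) (λ i → G (i ∷ v)) (ℓ (len v)))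
  searchMin-closed {n} {len} {P} {G} lenᶜ Pᶜ Gᶜ =
    sg*-closed minimisersᶜ (subst₀ (ap₂ minus (ap₁ ℓ′ lenᶜ) (ap₁ ℓ′ minimisersᶜ)) Gᶜ)
    where
    P′ : Vec ℕ n → ℕ → Bool
    P′ v i = P (i ∷ v)
    G′ : Vec ℕ n → ℕ → ℕ
    G′ v i = G (i ∷ v)
    undercutᶜ : ACDL 𝒞 (suc n) (λ w → undercut (P′ (tail w)) (G′ (tail w)) (ℓ (len (tail w))) (head w))
    undercutᶜ = ext (bin-closed (weaken lenᶜ) (∧-closed (weaken₁ Pᶜ) (<-closed (weaken₁ Gᶜ) (weaken Gᶜ)))
                                (χ≤1 ∘ _))
      λ { (_ ∷ _) → refl }
    digitᶜ : ACDL 𝒞 (suc n) (λ w → minimiserDigit (P′ (tail w)) (G′ (tail w)) (ℓ (len (tail w))) (head w))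
    digitᶜ = ext (ap₂ minus Pᶜ (ap₁ sg′ undercutᶜ)) λ { (_ ∷ _) → refl }
    minimisersᶜ : ACDL 𝒞 n (λ v → minimisers (P′ v) (G′ v) (ℓ (len v)))
    minimisersᶜ = bin-closed lenᶜ digitᶜ λ { (i ∷ v) → minimiserDigit≤1 (P′ v) (G′ v) (ℓ (len v)) i }

lemma4 : (𝒞 : CircuitFamily) (n : ℕ) (g h : Vec ℕ (suc (suc n)) → ℕ) →
    ACDL 𝒞 (suc (suc n)) g → ACDL 𝒞 (suc (suc n)) h →
    (k : ℕ) (▷ : Cmp) (j : ℕ) → j ≤ 1 →
    ACDL 𝒞 (suc n) (boundedMin g h ▷ j k)
-- The construction works for every j.
lemma4 𝒞 n g h gᶜ hᶜ k ▷ j _ =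
  ext (searchMin-closed lenᶜ (holds-closed ▷ hᶜ (const j)) gᶜ) λ { v@(x ∷ _) → begin
    searchMin (P v) (G v) (ℓ (len v))     ≡⟨ cong (searchMin (P v) (G v)) (ℓ-len x) ⟩
    searchMin (P v) (G v) (suc (ℓ x ^ k)) ≡⟨ bmin≡searchMin (P v) (G v) (ℓ x ^ k) ⟨
    boundedMin g h ▷ j k v                ∎ }
  where
  open ≡-Reasoning
  P : Vec ℕ (suc n) → ℕ → Bool
  P v i = holds ▷ (h (i ∷ v)) j
  G : Vec ℕ (suc n) → ℕ → ℕ
  G v i = g (i ∷ v)
  len : Vec ℕ (suc n) → ℕ
  len v = 2 * (head v #^ k) + 1
  ℓ-len : ∀ x → ℓ (2 * (x #^ k) + 1) ≡ suc (ℓ x ^ k)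
  ℓ-len x = trans (ℓ[2n+1] (x #^ k)) (cong suc (ℓ-#^ x k))
  lenᶜ : ACDL 𝒞 (suc n) len
  lenᶜ = ext (ap₂ plus (ap₂ plus x#^kᶜ x#^kᶜ) (const 1))
    λ { (x ∷ _) → cong (λ m → x #^ k + m + 1) (sym (+-identityʳ (x #^ k))) }
    where
    x#^kᶜ : ACDL 𝒞 (suc n) (λ v → lookup v zero #^ k)
    x#^kᶜ = #^-closed k (proj zero)
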